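{- Let $\phi$ be a discrete-time STL formula in strict normal form. If $\phi$ is satisfiable (there is a signal $w$ with $(w,0)\models\phi$), then the basic tableau for $\phi$ has an accepted branch.
   Context: Discrete-time STL. Fix a finite set $S=\{x_1,\dots,x_n\}$ of real-valued signal variables; a signal is $w:\mathbb{N}\to\mathbb{R}^n$. Atomic constraints are $f(R)=k$ and $f(R)>k$ with $R\subseteq S$, $f$ linear, $k\in\mathbb{Q}$; terms are $\top$, atomic constraints and their negations. For $a\le b$ in $\mathbb{N}$: $(w,t)\models \psi_1\,\mathsf{sU}_{[a,b]}\,\psi_2$ iff there is $t'\in[t+a,t+b]$ with $(w,t')\models\psi_2$ and $(w,t'')\models\psi_1$ for all $t''\in[t+a,t'-1]$; $(w,t)\models \psi_1\,\mathsf{sR}_{[a,b]}\,\psi_2$ iff for all $t'\in[t+a,t+b]$, $(w,t')\models\psi_2$ or some $t''\in[t+a,t'-1]$ has $(w,t'')\models\psi_1$. Strict normal form: built from terms using only $\wedge,\vee,\mathsf{sU},\mathsf{sR}$. Basic tableau. Node labels contain formulas where temporal operators $\psi_1\,\mathsf{B}_I\,\psi_2$ ($\mathsf{B}\in\{\mathsf{sU},\mathsf{sR}\}$) may be marked ($\overline{\mathsf{B}}$). $\exp^t$ is the identity on terms, commutes with $\neg,\wedge,\vee$, and maps $\psi_1\,\mathsf{B}_{[a,b]}\,\psi_2$ to $\psi_1\,\mathsf{B}_{[a+t,b+t]}\,\psi_2$. Each node $u$ has label $\Gamma(u)$ and time $t(u)$; the root has $t=0$, $\Gamma=\{\phi\}$.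 (Expansion) If $\Gamma(u)$ contains a $\psi$ of one of these forms, pick one and create children with the same time and $\Gamma(u_i)=(\Gamma(u)\setminus\{\psi\})\cup\Gamma_i$: $\psi_1\vee\psi_2$: $\Gamma_1=\{\psi_1\}$, $\Gamma_2=\{\psi_2\}$; $\psi_1\wedge\psi_2$: one child with $\Gamma_1=\{\psi_1,\psi_2\}$; unmarked $\psi_1\,\mathsf{sU}_I\,\psi_2$ with $t(u)\in I$: $\Gamma_1=\{\exp^{t(u)}(\psi_2)\}$, $\Gamma_2=\{\exp^{t(u)}(\psi_1),\psi_1\,\overline{\mathsf{sU}}_I\,\psi_2\}$; unmarked $\psi_1\,\mathsf{sR}_I\,\psi_2$ with $t(u)\in I$: $\Gamma_1=\{\exp^{t(u)}(\psi_1\wedge\psi_2)\}$, $\Gamma_2=\{\exp^{t(u)}(\psi_2),\psi_1\,\overline{\mathsf{sR}}_I\,\psi_2\}$. A node with no applicable expansion rule is poised. A poised $u$ is rejected if $\neg\top\in\Gamma(u)$, or the set of atomic and negated atomic constraints in $\Gamma(u)$ is unsatisfiable over the reals, or $\Gamma(u)$ contains a marked $\psi_1\,\overline{\mathsf{sU}}_{[a,b]}\,\psi_2$ with $b=t(u)$; otherwise it is accepted if $\Gamma(u)$ contains no temporal operators. Accepted and rejected nodes are leaves. Every other poised node $u$ gets one child $u'$ by the STEP rule: $t(u')=t(u)+1$ and $\Gamma(u')$ consists of the unmarked temporal operators in $\Gamma(u)$ together with the unmarked copies $\psi_1\,\mathsf{B}_{[a,b]}\,\psi_2$ of the marked operators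 $\psi_1\,\overline{\mathsf{B}}_{[a,b]}\,\psi_2\in\Gamma(u)$ with $t(u)<b$. An accepted branch is a branch from the root ending in an accepted node.
   Formalization: The linear functions f in the atomic constraints have rational coefficients rather than arbitrary real ones. -}

module Defs where

open import Data.Nat using (ℕ; zero; suc; _+_; _≤_; _<_)
open import Data.Rational using (ℚ)
open import Data.Bool using (Bool; true; false)
open import Data.Vec using (Vec; foldr′; zipWith)
open import Data.List using (List; []; _∷_)
open import Data.List.Membership.Propositional using (_∈_)
open import Data.Product using (Σ; _×_; _,_)
open import Data.Sum using (_⊎_)
open import Data.Unit using (⊤)
open import Data.Empty using (⊥)
open import Relation.Nullary using (¬_)
open import Relation.Binary.PropositionalEquality using (_≡_; _≢_)

-- The paper uses the reals; agda-stdlib has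
-- no reals, so we quantify over an arbitrary "real-like" domain: a
-- carrier with +, *, 0, a strict order and an embedding of ℚ.
-- The reals are an instance.

record Domain : Set₁ where
  field
    Carrier : Set
    _⊕_     : Carrier → Carrier → Carrier
    _⊛_     : Carrier → Carrier → Carrier
    0#      : Carrier
    _≺_     : Carrier → Carrier → Set
    fromℚ   : ℚ → Carrier

-- Syntax.  n = number of signal variables.  A linear function f(R) is
-- given by its coefficient vector (coefficient 0 for variables not in R).
-- Temporal operators carry a mark flag (true = marked, i.e. overline).

data Op : Set where
  sU sR : Op

infixr 6 _∧_
infixr 5 _∨_

data Form (n : ℕ) : Set where
  tt   : Form n
  eqA  : Vec ℚ n → ℚ → Form n
  gtA  : Vec ℚ n → ℚ → Form n
  neg  : Form n → Form n
  _∧_  : Form n → Form n → Form n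
  _∨_  : Form n → Form n → Form n
  tmp  : Op → Bool → ℕ → ℕ → Form n → Form n → Form n

data IsAtomOrTop {n : ℕ} : Form n → Set where
  tt-at  : IsAtomOrTop tt
  eqA-at : ∀ c k → IsAtomOrTop (eqA c k)
  gtA-at : ∀ c k → IsAtomOrTop (gtA c k)

data IsTerm {n : ℕ} : Form n → Set where
  pos-term : ∀ {φ} → IsAtomOrTop φ → IsTerm φ
  neg-term : ∀ {φ} → IsAtomOrTop φ → IsTerm (neg φ)

data SNF {n : ℕ} : Form n → Set where
  snf-term : ∀ {φ} → IsTerm φ → SNF φ
  snf-∧    : ∀ {φ ψ} → SNF φ → SNF ψ → SNF (φ ∧ ψ)
  snf-∨    : ∀ {φ ψ} → SNF φ → SNF ψ → SNF (φ ∨ ψ)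
  snf-tmp  : ∀ {B a b φ ψ} → a ≤ b → SNF φ → SNF ψ → SNF (tmp B false a b φ ψ)

module _ (D : Domain) where
  open Domain D

  lin : {n : ℕ} → Vec ℚ n → Vec Carrier n → Carrier
  lin c v = foldr′ _⊕_ 0# (zipWith (λ q x → fromℚ q ⊛ x) c v)

  Signal : ℕ → Set
  Signal n = ℕ → Vec Carrier n

  Sat : {n : ℕ} → Signal n → ℕ → Form n → Set
  Sat w t tt        = ⊤
  Sat w t (eqA c k) = lin c (w t) ≡ fromℚ k
  Sat w t (gtA c k) = fromℚ k ≺ lin c (w t)
  Sat w t (neg φ)   = ¬ Sat w t φ
  Sat w t (φ ∧ ψ)   = Sat w t φ × Sat w t ψ
  Sat w t (φ ∨ ψ)   = Sat w t φ ⊎ Sat w t ψ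
  Sat w t (tmp sU _ a b φ ψ) =
    Σ ℕ λ t′ → t + a ≤ t′ × t′ ≤ t + b × Sat w t′ ψ ×
      (∀ t″ → t + a ≤ t″ → t″ < t′ → Sat w t″ φ)
  Sat w t (tmp sR _ a b φ ψ) =
    ∀ t′ → t + a ≤ t′ → t′ ≤ t + b →
      Sat w t′ ψ ⊎ (Σ ℕ λ t″ → t + a ≤ t″ × t″ < t′ × Sat w t″ φ)

  Satisfiable : {n : ℕ} → Form n → Set
  Satisfiable {n} φ = Σ (Signal n) λ w → Sat w 0 φ

  HoldsLit : {n : ℕ} → Vec Carrier n → Form n → Set
  HoldsLit v (eqA c k)       = lin c v ≡ fromℚ k
  HoldsLit v (gtA c k)       = fromℚ k ≺ lin c v
  HoldsLit v (neg (eqA c k)) = ¬ (lin c v ≡ fromℚ k)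
  HoldsLit v (neg (gtA c k)) = ¬ (fromℚ k ≺ lin c v)
  HoldsLit v _               = ⊤

expT : {n : ℕ} → ℕ → Form n → Form n
expT t tt                 = tt
expT t (eqA c k)          = eqA c k
expT t (gtA c k)          = gtA c k
expT t (neg φ)            = neg (expT t φ)
expT t (φ ∧ ψ)            = expT t φ ∧ expT t ψ
expT t (φ ∨ ψ)            = expT t φ ∨ expT t ψ
expT t (tmp B m a b φ ψ)  = tmp B m (a + t) (b + t) φ ψ

-- Tableau labels are sets of formulas, represented as predicates.

Label : ℕ → Set₁
Label n = Form n → Set

replace : {n : ℕ} → Label n → Form n → List (Form n) → Label n
replace Γ ψ Γ′ χ = (Γ χ × χ ≢ ψ) ⊎ χ ∈ Γ′

data Expandable {n : ℕ} (t : ℕ) : Form n → Set where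
  exp-∨   : ∀ φ ψ → Expandable t (φ ∨ ψ)
  exp-∧   : ∀ φ ψ → Expandable t (φ ∧ ψ)
  exp-tmp : ∀ B a b φ ψ → a ≤ t → t ≤ b → Expandable t (tmp B false a b φ ψ)

Poised : {n : ℕ} → ℕ → Label n → Set
Poised t Γ = ∀ χ → Γ χ → ¬ Expandable t χ

data IsTemporal {n : ℕ} : Form n → Set where
  is-tmp : ∀ B m a b φ ψ → IsTemporal (tmp B m a b φ ψ)

module _ (D : Domain) where
  open Domain D

  LitSatisfiable : {n : ℕ} → Label n → Set
  LitSatisfiable {n} Γ = Σ (Vec Carrier n) λ v → ∀ χ → Γ χ → HoldsLit D v χ

  Rejected : {n : ℕ} → ℕ → Label n → Set
  Rejected t Γ =
    Γ (neg tt) ⊎ ¬ LitSatisfiable Γ ⊎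
    (Σ ℕ λ a → Σ _ λ φ → Σ _ λ ψ → Γ (tmp sU true a t φ ψ))

NoTemporal : {n : ℕ} → Label n → Set
NoTemporal Γ = ∀ χ → Γ χ → ¬ IsTemporal χ

stepLabel : {n : ℕ} → ℕ → Label n → Label n
stepLabel t Γ χ =
  (Γ χ × Σ Op λ B → Σ ℕ λ a → Σ ℕ λ b → Σ _ λ φ → Σ _ λ ψ → χ ≡ tmp B false a b φ ψ)
  ⊎ (Σ Op λ B → Σ ℕ λ a → Σ ℕ λ b → Σ _ λ φ → Σ _ λ ψ →
       χ ≡ tmp B false a b φ ψ × Γ (tmp B true a b φ ψ) × t < b)

-- Basic tableaux: Tab D t Γ is a (finite) tableau rooted at a node with
-- time t and label Γ, built with an arbitrary choice of the formula to
-- expand at each node.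

data Tab {n : ℕ} (D : Domain) (t : ℕ) (Γ : Label n) : Set where
  rule-∨ : ∀ φ ψ → Γ (φ ∨ ψ) →
           Tab D t (replace Γ (φ ∨ ψ) (φ ∷ [])) →
           Tab D t (replace Γ (φ ∨ ψ) (ψ ∷ [])) → Tab D t Γ
  rule-∧ : ∀ φ ψ → Γ (φ ∧ ψ) →
           Tab D t (replace Γ (φ ∧ ψ) (φ ∷ ψ ∷ [])) → Tab D t Γ
  rule-sU : ∀ a b φ ψ → Γ (tmp sU false a b φ ψ) → a ≤ t → t ≤ b →
           Tab D t (replace Γ (tmp sU false a b φ ψ) (expT t ψ ∷ [])) →
           Tab D t (replace Γ (tmp sU false a b φ ψ)
                      (expT t φ ∷ tmp sU true a b φ ψ ∷ [])) → Tab D t Γ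
  rule-sR : ∀ a b φ ψ → Γ (tmp sR false a b φ ψ) → a ≤ t → t ≤ b →
           Tab D t (replace Γ (tmp sR false a b φ ψ) (expT t (φ ∧ ψ) ∷ [])) →
           Tab D t (replace Γ (tmp sR false a b φ ψ)
                      (expT t ψ ∷ tmp sR true a b φ ψ ∷ [])) → Tab D t Γ
  leaf-rej : Poised t Γ → Rejected D t Γ → Tab D t Γ
  leaf-acc : Poised t Γ → ¬ Rejected D t Γ → NoTemporal Γ → Tab D t Γ
  step     : Poised t Γ → ¬ Rejected D t Γ → ¬ NoTemporal Γ →
             Tab D (suc t) (stepLabel t Γ) → Tab D t Γ

HasAcceptedBranch : {n : ℕ} {D : Domain} {t : ℕ} {Γ : Label n} → Tab D t Γ → Set
HasAcceptedBranch (rule-∨ _ _ _ T₁ T₂)        = HasAcceptedBranch T₁ ⊎ HasAcceptedBranch T₂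
HasAcceptedBranch (rule-∧ _ _ _ T)            = HasAcceptedBranch T
HasAcceptedBranch (rule-sU _ _ _ _ _ _ _ T₁ T₂) = HasAcceptedBranch T₁ ⊎ HasAcceptedBranch T₂
HasAcceptedBranch (rule-sR _ _ _ _ _ _ _ T₁ T₂) = HasAcceptedBranch T₁ ⊎ HasAcceptedBranch T₂
HasAcceptedBranch (leaf-rej _ _)              = ⊥
HasAcceptedBranch (leaf-acc _ _ _)            = ⊤
HasAcceptedBranch (step _ _ _ T)              = HasAcceptedBranch T

rootLabel : {n : ℕ} → Form n → Label n
rootLabel φ χ = χ ≡ φ

-- Fix a signal w with (w, 0) ⊨ φ and call a tableau node at time t realised by w
-- when w meets every obligation in its label from time t on. The root is
-- realised; every expansion rule has a realised child, STEP preserves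
-- realisation, and a realised node is never rejected. Following realised
-- children therefore ends in an accepted leaf. At a release node the
-- branch is chosen by asking whether the first child already has an
-- accepted branch; if it has none, then φ₁ must fail at t, which is what
-- the second child needs.

module Submission where

open import Defs
open import Data.Nat using (ℕ; suc; _+_; _⊔_; _≤_; _<_; _≤?_)
open import Data.Nat.Properties
open import Data.Bool using (true; false)
open import Data.List using ([]; _∷_)
open import Data.List.Relation.Unary.All as All using (All; []; _∷_)
open import Data.Product using (Σ; _×_; _,_)
open import Data.Sum using (_⊎_; inj₁; inj₂)
open import Data.Unit using (⊤; tt)
open import Data.Empty using (⊥-elim)
open import Relation.Nullary using (¬_; Dec; yes; no)
open import Relation.Nullary.Decidable using (_⊎-dec_)
open import Relation.Binary.PropositionalEquality using (_≡_; refl; sym; trans; cong; cong₂; subst; subst₂)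

Until Release : (ℕ → Set) → (ℕ → Set) → ℕ → ℕ → Set
Until P Q lo hi =
  Σ ℕ λ t′ → lo ≤ t′ × t′ ≤ hi × Q t′ × (∀ t″ → lo ≤ t″ → t″ < t′ → P t″)
Release P Q lo hi =
  ∀ t′ → lo ≤ t′ → t′ ≤ hi → Q t′ ⊎ (Σ ℕ λ t″ → lo ≤ t″ × t″ < t′ × P t″)

Window : Op → (ℕ → Set) → (ℕ → Set) → ℕ → ℕ → Set
Window sU = Until
Window sR = Release

module _ {P Q : ℕ → Set} where

  Until⇒≤ : ∀ {lo hi} → Until P Q lo hi → lo ≤ hi
  Until⇒≤ (_ , lo≤t′ , t′≤hi , _) = ≤-trans lo≤t′ t′≤hi

  Until-unfold : ∀ {t hi} → Until P Q t hi → Q t ⊎ (P t × Until P Q (suc t) hi)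
  Until-unfold (t′ , t≤t′ , t′≤hi , Qt′ , P<t′) with m≤n⇒m<n∨m≡n t≤t′
  ... | inj₂ refl = inj₁ Qt′
  ... | inj₁ t<t′ =
    inj₂ (P<t′ _ ≤-refl t<t′ , t′ , t<t′ , t′≤hi , Qt′ , λ t″ t<t″ → P<t′ t″ (<⇒≤ t<t″))

  Release-vacuous : ∀ {lo hi} → hi < lo → Release P Q lo hi
  Release-vacuous hi<lo _ lo≤t′ t′≤hi = ⊥-elim (<⇒≱ hi<lo (≤-trans lo≤t′ t′≤hi))

  Release-unfold : ∀ {t hi} → t ≤ hi → Release P Q t hi →
                   Q t × (¬ P t → Release P Q (suc t) hi)
  Release-unfold {t} {hi} t≤hi r = now , later
    where
    now : Q t
    now with r t ≤-refl t≤hi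
    ... | inj₁ Qt = Qt
    ... | inj₂ (_ , t≤t″ , t″<t , _) = ⊥-elim (≤⇒≯ t≤t″ t″<t)

    later : ¬ P t → Release P Q (suc t) hi
    later ¬Pt t′ t<t′ t′≤hi with r t′ (<⇒≤ t<t′) t′≤hi
    ... | inj₁ Qt′ = inj₁ Qt′
    ... | inj₂ (t″ , t≤t″ , t″<t′ , Pt″) with m≤n⇒m<n∨m≡n t≤t″
    ...   | inj₁ t<t″ = inj₂ (t″ , t<t″ , t″<t′ , Pt″)
    ...   | inj₂ refl = ⊥-elim (¬Pt Pt″)

expT-zero : ∀ {n} (φ : Form n) → expT 0 φ ≡ φ
expT-zero tt                = refl
expT-zero (eqA c k)         = refl
expT-zero (gtA c k)         = refl
expT-zero (neg φ)           = cong neg (expT-zero φ)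
expT-zero (φ ∧ ψ)           = cong₂ _∧_ (expT-zero φ) (expT-zero ψ)
expT-zero (φ ∨ ψ)           = cong₂ _∨_ (expT-zero φ) (expT-zero ψ)
expT-zero (tmp B m a b φ ψ) = cong₂ (λ a′ b′ → tmp B m a′ b′ φ ψ) (+-identityʳ a) (+-identityʳ b)

hasAcceptedBranch? : ∀ {n D t} {Γ : Label n} (T : Tab D t Γ) → Dec (HasAcceptedBranch T)
hasAcceptedBranch? (rule-∨ _ _ _ T₁ T₂)          = hasAcceptedBranch? T₁ ⊎-dec hasAcceptedBranch? T₂
hasAcceptedBranch? (rule-∧ _ _ _ T)              = hasAcceptedBranch? T
hasAcceptedBranch? (rule-sU _ _ _ _ _ _ _ T₁ T₂) = hasAcceptedBranch? T₁ ⊎-dec hasAcceptedBranch? T₂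
hasAcceptedBranch? (rule-sR _ _ _ _ _ _ _ T₁ T₂) = hasAcceptedBranch? T₁ ⊎-dec hasAcceptedBranch? T₂
hasAcceptedBranch? (leaf-rej _ _)                = no λ ()
hasAcceptedBranch? (leaf-acc _ _ _)              = yes tt
hasAcceptedBranch? (step _ _ _ T)                = hasAcceptedBranch? T

module Realisation (D : Domain) {n : ℕ} (w : Signal D n) where

  Holds : Form n → ℕ → Set
  Holds φ t = Sat D w t φ

  Sat-tmp : ∀ {t} B m a b φ ψ → Holds (tmp B m a b φ ψ) t →
            Window B (Holds φ) (Holds ψ) (t + a) (t + b)
  Sat-tmp sU _ _ _ _ _ s = s
  Sat-tmp sR _ _ _ _ _ s = s

  -- An unmarked operator at time t owes its obligation restricted to times ≥ t;
  -- a marked one has been expanded at t and owes it strictly after t.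
  Realised : ℕ → Form n → Set
  Realised t tt                     = ⊤
  Realised t (eqA c k)              = Holds (eqA c k) t
  Realised t (gtA c k)              = Holds (gtA c k) t
  Realised t (neg χ)                = ¬ Holds χ t
  Realised t (χ₁ ∧ χ₂)              = Realised t χ₁ × Realised t χ₂
  Realised t (χ₁ ∨ χ₂)              = Realised t χ₁ ⊎ Realised t χ₂
  Realised t (tmp B false a b φ ψ) =
    SNF φ × SNF ψ × Window B (Holds φ) (Holds ψ) (a ⊔ t) b
  Realised t (tmp B true a b φ ψ)  =
    SNF φ × SNF ψ × a ≤ t × Window B (Holds φ) (Holds ψ) (suc t) b

  Realises : ℕ → Label n → Set
  Realises t Γ = ∀ χ → Γ χ → Realised t χ

  realised-expT : ∀ {t φ} → SNF φ → Holds φ t → Realised t (expT t φ)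
  realised-expT (snf-term (pos-term tt-at))        _ = tt
  realised-expT (snf-term (pos-term (eqA-at c k))) s = s
  realised-expT (snf-term (pos-term (gtA-at c k))) s = s
  realised-expT (snf-term (neg-term tt-at))        s = s
  realised-expT (snf-term (neg-term (eqA-at c k))) s = s
  realised-expT (snf-term (neg-term (gtA-at c k))) s = s
  realised-expT (snf-∧ p q) (s₁ , s₂) = realised-expT p s₁ , realised-expT q s₂
  realised-expT (snf-∨ p q) (inj₁ s)  = inj₁ (realised-expT p s)
  realised-expT (snf-∨ p q) (inj₂ s)  = inj₂ (realised-expT q s)
  realised-expT {t} (snf-tmp {B} {a} {b} {φ} {ψ} _ p q) s =
    p , q , subst₂ (Window B (Holds φ) (Holds ψ)) lower (+-comm t b) (Sat-tmp B false a b φ ψ s)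
    where
    lower : t + a ≡ (a + t) ⊔ t
    lower = trans (+-comm t a) (sym (m≥n⇒m⊔n≡m (m≤n+m t a)))

  realises-root : ∀ {φ} → SNF φ → Holds φ 0 → Realises 0 (rootLabel φ)
  realises-root {φ} snf s _ refl = subst (Realised 0) (expT-zero φ) (realised-expT snf s)

  realises-replace : ∀ {t Γ ψ Γ′} → Realises t Γ → All (Realised t) Γ′ →
                     Realises t (replace Γ ψ Γ′)
  realises-replace r _  χ (inj₁ (γ , _)) = r χ γ
  realises-replace _ r′ _ (inj₂ χ∈Γ′)    = All.lookup r′ χ∈Γ′

  realised⇒holdsLit : ∀ {t} χ → Realised t χ → HoldsLit D (w t) χ
  realised⇒holdsLit tt                      _ = tt
  realised⇒holdsLit (eqA c k)               r = r
  realised⇒holdsLit (gtA c k)               r = r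
  realised⇒holdsLit (neg tt)                _ = tt
  realised⇒holdsLit (neg (eqA c k))         r = r
  realised⇒holdsLit (neg (gtA c k))         r = r
  realised⇒holdsLit (neg (neg _))           _ = tt
  realised⇒holdsLit (neg (_ ∧ _))           _ = tt
  realised⇒holdsLit (neg (_ ∨ _))           _ = tt
  realised⇒holdsLit (neg (tmp _ _ _ _ _ _)) _ = tt
  realised⇒holdsLit (_ ∧ _)                 _ = tt
  realised⇒holdsLit (_ ∨ _)                 _ = tt
  realised⇒holdsLit (tmp _ _ _ _ _ _)       _ = tt

  realised⇒¬rejected : ∀ {t Γ} → Realises t Γ → ¬ Rejected D t Γ
  realised⇒¬rejected r (inj₁ γ)                     = r _ γ tt
  realised⇒¬rejected {t} r (inj₂ (inj₁ ¬litSat))    =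
    ¬litSat (w t , λ χ γ → realised⇒holdsLit χ (r χ γ))
  realised⇒¬rejected r (inj₂ (inj₂ (_ , _ , _ , γ))) with r _ γ
  ... | _ , _ , _ , u = <-irrefl refl (Until⇒≤ u)

  realised-step-unmarked : ∀ {t} B a b φ ψ → ¬ Expandable t (tmp B false a b φ ψ) →
    Realised t (tmp B false a b φ ψ) → Realised (suc t) (tmp B false a b φ ψ)
  realised-step-unmarked {t} B a b φ ψ ¬exp (p , q , win) with a ≤? t
  ... | no a≰t = p , q , subst (λ lo → Window B (Holds φ) (Holds ψ) lo b) not-yet-open win
    where
    t<a : t < a
    t<a = ≰⇒> a≰t
    not-yet-open : a ⊔ t ≡ a ⊔ suc t
    not-yet-open = trans (m≥n⇒m⊔n≡m (<⇒≤ t<a)) (sym (m≥n⇒m⊔n≡m t<a))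
  ... | yes a≤t = p , q , expired B win
    where
    b<t : b < t
    b<t = ≰⇒> λ t≤b → ¬exp (exp-tmp B a b φ ψ a≤t t≤b)
    expired : ∀ B′ → Window B′ (Holds φ) (Holds ψ) (a ⊔ t) b →
              Window B′ (Holds φ) (Holds ψ) (a ⊔ suc t) b
    expired sU u = ⊥-elim (<⇒≱ b<t (≤-trans (m≤n⊔m a t) (Until⇒≤ u)))
    expired sR _ = Release-vacuous (<-≤-trans (m<n⇒m<1+n b<t) (m≤n⊔m a (suc t)))

  realised-step-marked : ∀ {t} B a b φ ψ →
    Realised t (tmp B true a b φ ψ) → Realised (suc t) (tmp B false a b φ ψ)
  realised-step-marked B a b φ ψ (p , q , a≤t , win) =
    p , q , subst (λ lo → Window B (Holds φ) (Holds ψ) lo b)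
                  (sym (m≤n⇒m⊔n≡n (m≤n⇒m≤1+n a≤t))) win

  realises-step : ∀ {t Γ} → Poised t Γ → Realises t Γ → Realises (suc t) (stepLabel t Γ)
  realises-step P r _ (inj₁ (γ , B , a , b , φ , ψ , refl)) =
    realised-step-unmarked B a b φ ψ (P _ γ) (r _ γ)
  realises-step P r _ (inj₂ (B , a , b , φ , ψ , refl , γ , _)) =
    realised-step-marked B a b φ ψ (r _ γ)

  realised⇒acceptedBranch : ∀ {t Γ} (T : Tab D t Γ) → Realises t Γ → HasAcceptedBranch T
  realised⇒acceptedBranch (rule-∨ _ _ γ T₁ T₂) r with r _ γ
  ... | inj₁ r₁ = inj₁ (realised⇒acceptedBranch T₁ (realises-replace r (r₁ ∷ [])))
  ... | inj₂ r₂ = inj₂ (realised⇒acceptedBranch T₂ (realises-replace r (r₂ ∷ [])))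
  realised⇒acceptedBranch (rule-∧ _ _ γ T) r with r _ γ
  ... | r₁ , r₂ = realised⇒acceptedBranch T (realises-replace r (r₁ ∷ r₂ ∷ []))
  realised⇒acceptedBranch (rule-sU a b φ ψ γ a≤t _ T₁ T₂) r with r _ γ
  ... | p , q , win
      with Until-unfold (subst (λ lo → Until (Holds φ) (Holds ψ) lo b) (m≤n⇒m⊔n≡n a≤t) win)
  ...   | inj₁ ψt =
    inj₁ (realised⇒acceptedBranch T₁ (realises-replace r (realised-expT q ψt ∷ [])))
  ...   | inj₂ (φt , win′) = inj₂ (realised⇒acceptedBranch T₂
                              (realises-replace r (realised-expT p φt ∷ (p , q , a≤t , win′) ∷ [])))
  realised⇒acceptedBranch {t} (rule-sR a b φ ψ γ a≤t t≤b T₁ T₂) r with r _ γ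
  ... | p , q , win
      with Release-unfold t≤b (subst (λ lo → Release (Holds φ) (Holds ψ) lo b) (m≤n⇒m⊔n≡n a≤t) win)
  ...   | ψt , win′ with hasAcceptedBranch? T₁
  ...     | yes acc₁ = inj₁ acc₁
  ...     | no ¬acc₁ = inj₂ (realised⇒acceptedBranch T₂
                         (realises-replace r (realised-expT q ψt ∷ (p , q , a≤t , win′ ¬φt) ∷ [])))
    where
    ¬φt : ¬ Holds φ t
    ¬φt φt = ¬acc₁ (realised⇒acceptedBranch T₁
               (realises-replace r ((realised-expT p φt , realised-expT q ψt) ∷ [])))
  realised⇒acceptedBranch (leaf-rej _ rej)  r = ⊥-elim (realised⇒¬rejected r rej)
  realised⇒acceptedBranch (leaf-acc _ _ _)  _ = tt
  realised⇒acceptedBranch (step P _ _ T)    r = realised⇒acceptedBranch T (realises-step P r)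

lemma4p7 : (D : Domain) (n : ℕ) (φ : Form n) → SNF φ → Satisfiable D φ →
    (T : Tab D 0 (rootLabel φ)) → HasAcceptedBranch T
lemma4p7 D n φ snf (w , w⊨φ) T =
  realised⇒acceptedBranch T (realises-root snf w⊨φ)
  where open Realisation D w
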